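{- Let $\mathcal{D}$ be a finite structure with domain $D$, and let $U,X,U',X'\subseteq D$ be such that both pairs $(U,X)$ and $(U',X')$ are selected as in the definition of a $U$-$X$-core of $\mathcal{D}$, with $U\cup X=D=U'\cup X'$ (so $\mathcal{D}$ is both a $U$-$X$-core and a $U'$-$X'$-core of itself). Then $U=U'$ and $X=X'$.
   Context: Structures are finite relational structures with nonempty domain. A shop of $D$ is a map $f$ from $D$ to the power set of $D$ with $f(d)\neq\emptyset$ for all $d$ and $\bigcup_d f(d)=D$; it is a surjective hyper-endomorphism of $\mathcal{D}$ if for each relation $R$ of arity $i$, $R(a_1,\dots,a_i)$ in $\mathcal{D}$ implies $R(b_1,\dots,b_i)$ in $\mathcal{D}$ for all $b_j\in f(a_j)$. $f(S)=\bigcup_{s\in S}f(s)$; $f$ is $U$-surjective if $f(U)=D$ and $X$-total if $f(d)\cap X\neq\emptyset$ for all $d$. Selection of $(U,X)$ for a $U$-$X$-core: $U$ has minimum cardinality among subsets $U''$ for which a $U''$-surjective surjective hyper-endomorphism of $\mathcal{D}$ exists, $X$ has minimum cardinality among subsets $X''$ for which an $X''$-total surjective hyper-endomorphism exists, and among all such choices $|U\cap X|$ is maximum; the substructure induced by $U\cup X$ is then a $U$-$X$-core of $\mathcal{D}$. -}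

module Defs where

open import Data.Nat using (ℕ; _≤_)
open import Data.Fin using (Fin)
open import Data.Fin.Subset using (Subset; _∈_; _∪_; _∩_; ∣_∣; Nonempty; ⊤)
open import Data.Bool using (Bool; true)
open import Data.Product using (Σ; ∃; _×_)
open import Relation.Binary.PropositionalEquality using (_≡_)

record Structure (n : ℕ) : Set where
  field
    nrel  : ℕ
    arity : Fin nrel → ℕ
    rel   : (r : Fin nrel) → (Fin (arity r) → Fin n) → Bool

open Structure public

Holds : ∀ {n} (𝒟 : Structure n) (r : Fin (nrel 𝒟)) → (Fin (arity 𝒟 r) → Fin n) → Set
Holds 𝒟 r a = rel 𝒟 r a ≡ true

HyperMap : ℕ → Set
HyperMap n = Fin n → Subset n

_∈Img_[_] : ∀ {n} → Fin n → HyperMap n → Subset n → Set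
b ∈Img f [ S ] = ∃ λ s → s ∈ S × b ∈ f s

IsShop : ∀ {n} → HyperMap n → Set
IsShop {n} f = (∀ d → Nonempty (f d)) × (∀ b → b ∈Img f [ ⊤ ])

IsSHE : ∀ {n} → Structure n → HyperMap n → Set
IsSHE 𝒟 f = IsShop f ×
  (∀ r (a : Fin (arity 𝒟 r) → Fin _) → Holds 𝒟 r a →
     ∀ (b : Fin (arity 𝒟 r) → Fin _) → (∀ j → b j ∈ f (a j)) → Holds 𝒟 r b)

USurjective : ∀ {n} → Subset n → HyperMap n → Set
USurjective U f = ∀ b → b ∈Img f [ U ]

XTotal : ∀ {n} → Subset n → HyperMap n → Set
XTotal X f = ∀ d → Nonempty (f d ∩ X)

HasUSurjSHE : ∀ {n} → Structure n → Subset n → Set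
HasUSurjSHE 𝒟 U = ∃ λ f → IsSHE 𝒟 f × USurjective U f

HasXTotalSHE : ∀ {n} → Structure n → Subset n → Set
HasXTotalSHE 𝒟 X = ∃ λ f → IsSHE 𝒟 f × XTotal X f

MinU : ∀ {n} → Structure n → Subset n → Set
MinU 𝒟 U = HasUSurjSHE 𝒟 U × (∀ U'' → HasUSurjSHE 𝒟 U'' → ∣ U ∣ ≤ ∣ U'' ∣)

MinX : ∀ {n} → Structure n → Subset n → Set
MinX 𝒟 X = HasXTotalSHE 𝒟 X × (∀ X'' → HasXTotalSHE 𝒟 X'' → ∣ X ∣ ≤ ∣ X'' ∣)

Selected : ∀ {n} → Structure n → Subset n → Subset n → Set
Selected 𝒟 U X = MinU 𝒟 U × MinX 𝒟 X ×
  (∀ U'' X'' → MinU 𝒟 U'' → MinX 𝒟 X'' → ∣ U'' ∩ X'' ∣ ≤ ∣ U ∩ X ∣)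

-- By minimality, any choice function for a U-surjective, X-total surjective hyper-endomorphism p
-- is injective on U and on X, so a suitable power z of p satisfies d ∈ z d for every d ∈ U ∪ X = D.
-- Maximality of |U ∩ X| forces every pair of minimal sets to cover D; with an exchange argument this
-- shows that X-total maps send X into X and U-surjective maps pull U back into U. Composing an
-- X'-total map with z yields a map that is X-total and X'-total at once, so X ∩ X' admits an X-total
-- map and minimality gives X ⊆ X'; likewise U ⊆ U', and the theorem follows by symmetry.
module Submission where

open import Defs
open import Data.Bool using (true)
open import Data.Fin using (Fin; zero; suc; toℕ; _≟_)
open import Data.Fin.Properties using (any?; pigeonhole; toℕ<n)
open import Data.Fin.Subset
open import Data.Fin.Subset.Properties
open import Data.Nat using (ℕ; zero; suc; pred; _+_; _*_; _∸_; _≤_; _<_; s≤s; _!)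
open import Data.Nat.Divisibility using (_∣_; divides; ∣-trans; m∣m*n; m≤n⇒m!∣n!)
open import Data.Nat.GeneralisedArithmetic using (fold; iterate; fold-+; iterate-is-fold)
open import Data.Nat.Properties
  using (+-suc; +-comm; m≤m+n; ≤-reflexive; ≤-trans; ≤-antisym; <⇒≤; <⇒≱; +-monoʳ-≤;
         +-cancelʳ-≤; m+[n∸m]≡n; m∸n≤m; m<n⇒0<n∸m; n<1+n; ≤-pred; suc-pred; _!≢0; module ≤-Reasoning)
open import Data.Product using (Σ-syntax; ∃; _×_; _,_; proj₁; proj₂)
open import Data.Sum using (_⊎_; inj₁; inj₂)
open import Data.Vec using (tabulate; _∷_; []; here; there)
open import Data.Vec.Properties using (lookup∘tabulate; []=⇒lookup; lookup⇒[]=)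
open import Function using (_∘_)
open import Relation.Nullary using (Dec; yes; no; does; contradiction)
open import Relation.Nullary.Decidable using (_×-dec_; dec-true)
open import Relation.Binary.PropositionalEquality

private variable
  m n : ℕ

∣p∪q∣+∣p∩q∣≡∣p∣+∣q∣ : (p q : Subset n) → ∣ p ∪ q ∣ + ∣ p ∩ q ∣ ≡ ∣ p ∣ + ∣ q ∣
∣p∪q∣+∣p∩q∣≡∣p∣+∣q∣ []            []            = refl
∣p∪q∣+∣p∩q∣≡∣p∣+∣q∣ (inside  ∷ p) (inside  ∷ q) =
  cong suc (trans (+-suc _ _) (trans (cong suc (∣p∪q∣+∣p∩q∣≡∣p∣+∣q∣ p q)) (sym (+-suc _ _))))
∣p∪q∣+∣p∩q∣≡∣p∣+∣q∣ (inside  ∷ p) (outside ∷ q) = cong suc (∣p∪q∣+∣p∩q∣≡∣p∣+∣q∣ p q)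
∣p∪q∣+∣p∩q∣≡∣p∣+∣q∣ (outside ∷ p) (inside  ∷ q) =
  trans (cong suc (∣p∪q∣+∣p∩q∣≡∣p∣+∣q∣ p q)) (sym (+-suc _ _))
∣p∪q∣+∣p∩q∣≡∣p∣+∣q∣ (outside ∷ p) (outside ∷ q) = ∣p∪q∣+∣p∩q∣≡∣p∣+∣q∣ p q

∣p∪q∣≤∣p∣+∣q∣ : (p q : Subset n) → ∣ p ∪ q ∣ ≤ ∣ p ∣ + ∣ q ∣
∣p∪q∣≤∣p∣+∣q∣ p q = subst (∣ p ∪ q ∣ ≤_) (∣p∪q∣+∣p∩q∣≡∣p∣+∣q∣ p q) (m≤m+n _ _)

x∈p─q⇒x∉q : ∀ {p q : Subset n} {x} → x ∈ p ─ q → x ∉ q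
x∈p─q⇒x∉q {p = inside  ∷ p} {inside  ∷ q} () here
x∈p─q⇒x∉q {p = outside ∷ p} {inside  ∷ q} () here
x∈p─q⇒x∉q {p = _ ∷ p} {_ ∷ q} (there x∈p─q) (there x∈q) = x∈p─q⇒x∉q x∈p─q x∈q

p⊆q∧∣q∣≤∣p∣⇒q⊆p : ∀ {p q : Subset n} → p ⊆ q → ∣ q ∣ ≤ ∣ p ∣ → q ⊆ p
p⊆q∧∣q∣≤∣p∣⇒q⊆p {p = p} p⊆q ∣q∣≤∣p∣ {x} x∈q with x ∈? p
... | yes x∈p = x∈p
... | no  x∉p = contradiction ∣q∣≤∣p∣ (<⇒≱ (p⊂q⇒∣p∣<∣q∣ (p⊆q , x , x∈q , x∉p)))

∣p∣≤∣p∩q∣⇒p⊆q : ∀ {p q : Subset n} → ∣ p ∣ ≤ ∣ p ∩ q ∣ → p ⊆ q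
∣p∣≤∣p∩q∣⇒p⊆q {p = p} {q} ∣p∣≤∣p∩q∣ = p∩q⊆q p q ∘ p⊆q∧∣q∣≤∣p∣⇒q⊆p (p∩q⊆p p q) ∣p∣≤∣p∩q∣

exchange : Subset n → Fin n → Fin n → Subset n
exchange p x y = (p - x) ∪ ⁅ y ⁆

∣exchange∣≤ : ∀ {p : Subset n} {x} y → x ∈ p → ∣ exchange p x y ∣ ≤ ∣ p ∣
∣exchange∣≤ {p = p} {x} y x∈p = begin
  ∣ (p - x) ∪ ⁅ y ⁆ ∣   ≤⟨ ∣p∪q∣≤∣p∣+∣q∣ (p - x) ⁅ y ⁆ ⟩
  ∣ p - x ∣ + ∣ ⁅ y ⁆ ∣ ≡⟨ cong (∣ p - x ∣ +_) (∣⁅x⁆∣≡1 y) ⟩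
  ∣ p - x ∣ + 1         ≡⟨ +-comm ∣ p - x ∣ 1 ⟩
  suc ∣ p - x ∣         ≤⟨ x∈p⇒∣p-x∣<∣p∣ x∈p ⟩
  ∣ p ∣                 ∎
  where open ≤-Reasoning

y∈exchange : ∀ {p : Subset n} x y → y ∈ exchange p x y
y∈exchange x y = x∈p∪q⁺ (inj₂ (x∈⁅x⁆ y))

z∈exchange : ∀ {p : Subset n} {x z} y → z ∈ p → z ≢ x → z ∈ exchange p x y
z∈exchange y z∈p z≢x = x∈p∪q⁺ (inj₁ (x∈p∧x≢y⇒x∈p-y z∈p z≢x))

x∉exchange : ∀ {p : Subset n} {x y} → x ≢ y → x ∉ exchange p x y
x∉exchange {p = p} {x} {y} x≢y x∈ with x∈p∪q⁻ (p - x) ⁅ y ⁆ x∈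
... | inj₁ x∈p-x = x∈p─q⇒x∉q x∈p-x (x∈⁅x⁆ x)
... | inj₂ x∈⁅y⁆ = x≢y (x∈⁅y⁆⇒x≡y y x∈⁅y⁆)

InjectiveOn : Subset m → (Fin m → Fin n) → Set
InjectiveOn p f = ∀ {x y} → x ∈ p → y ∈ p → f x ≡ f y → x ≡ y

image : (Fin m → Fin n) → Subset m → Subset n
image f []            = ⊥
image f (inside  ∷ p) = ⁅ f zero ⁆ ∪ image (f ∘ suc) p
image f (outside ∷ p) = image (f ∘ suc) p

∈image⁺ : ∀ (f : Fin m → Fin n) {p x} → x ∈ p → f x ∈ image f p
∈image⁺ f {inside  ∷ p} here         = x∈p∪q⁺ (inj₁ (x∈⁅x⁆ (f zero)))
∈image⁺ f {inside  ∷ p} (there x∈p)  = x∈p∪q⁺ (inj₂ (∈image⁺ (f ∘ suc) x∈p))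
∈image⁺ f {outside ∷ p} (there x∈p)  = ∈image⁺ (f ∘ suc) x∈p

∈image⁻ : ∀ (f : Fin m → Fin n) p {y} → y ∈ image f p → ∃ λ x → x ∈ p × f x ≡ y
∈image⁻ f []            y∈ = contradiction y∈ ∉⊥
∈image⁻ f (inside  ∷ p) y∈ with x∈p∪q⁻ _ _ y∈
... | inj₁ y∈⁅f0⁆ = zero , here , sym (x∈⁅y⁆⇒x≡y _ y∈⁅f0⁆)
... | inj₂ y∈img  = let x , x∈p , fx≡y = ∈image⁻ (f ∘ suc) p y∈img in suc x , there x∈p , fx≡y
∈image⁻ f (outside ∷ p) y∈ = let x , x∈p , fx≡y = ∈image⁻ (f ∘ suc) p y∈ in suc x , there x∈p , fx≡y

∣image∣≤∣p∣ : ∀ (f : Fin m → Fin n) p → ∣ image f p ∣ ≤ ∣ p ∣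
∣image∣≤∣p∣ {n = n} f [] = ≤-reflexive (∣⊥∣≡0 n)
∣image∣≤∣p∣ f (inside ∷ p) = begin
  ∣ ⁅ f zero ⁆ ∪ image (f ∘ suc) p ∣          ≤⟨ ∣p∪q∣≤∣p∣+∣q∣ ⁅ f zero ⁆ _ ⟩
  ∣ ⁅ f zero ⁆ ∣ + ∣ image (f ∘ suc) p ∣      ≡⟨ cong (_+ ∣ image (f ∘ suc) p ∣) (∣⁅x⁆∣≡1 (f zero)) ⟩
  suc ∣ image (f ∘ suc) p ∣                   ≤⟨ s≤s (∣image∣≤∣p∣ (f ∘ suc) p) ⟩
  suc ∣ p ∣                                   ∎
  where open ≤-Reasoning
∣image∣≤∣p∣ f (outside ∷ p) = ∣image∣≤∣p∣ (f ∘ suc) p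

-- Removing y from p loses nothing from the image, since f y is still hit by x.
∣image∣<∣p∣ : ∀ (f : Fin m → Fin n) p {x y} → x ∈ p → y ∈ p → x ≢ y → f x ≡ f y → ∣ image f p ∣ < ∣ p ∣
∣image∣<∣p∣ f p {x} {y} x∈p y∈p x≢y fx≡fy = begin-strict
  ∣ image f p ∣         ≤⟨ p⊆q⇒∣p∣≤∣q∣ image⊆ ⟩
  ∣ image f (p - y) ∣   ≤⟨ ∣image∣≤∣p∣ f (p - y) ⟩
  ∣ p - y ∣             <⟨ x∈p⇒∣p-x∣<∣p∣ y∈p ⟩
  ∣ p ∣                 ∎
  where
  open ≤-Reasoning
  image⊆ : image f p ⊆ image f (p - y)
  image⊆ z∈ with ∈image⁻ f p z∈
  ... | t , t∈p , refl with t ≟ y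
  ...   | yes refl = subst (_∈ image f (p - y)) fx≡fy (∈image⁺ f (x∈p∧x≢y⇒x∈p-y x∈p x≢y))
  ...   | no  t≢y  = ∈image⁺ f (x∈p∧x≢y⇒x∈p-y t∈p t≢y)

∣p∣≤∣image∣⇒injectiveOn : ∀ (f : Fin m → Fin n) p → ∣ p ∣ ≤ ∣ image f p ∣ → InjectiveOn p f
∣p∣≤∣image∣⇒injectiveOn f p ∣p∣≤∣image∣ {x} {y} x∈p y∈p fx≡fy with x ≟ y
... | yes x≡y = x≡y
... | no  x≢y = contradiction ∣p∣≤∣image∣ (<⇒≱ (∣image∣<∣p∣ f p x∈p y∈p x≢y fx≡fy))

0<k≤n⇒k∣n! : ∀ {k n} → 0 < k → k ≤ n → k ∣ n !
0<k≤n⇒k∣n! {suc k} _ k≤n = ∣-trans (m∣m*n (k !)) (m≤n⇒m!∣n! k≤n)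

fold-periodic : ∀ {a} {A : Set a} (f : A → A) x k → fold x f k ≡ x → ∀ q → fold x f (q * k) ≡ x
fold-periodic f x k fᵏx≡x zero    = refl
fold-periodic f x k fᵏx≡x (suc q) = begin
  fold x f (k + q * k)            ≡⟨ fold-+ x f k ⟩
  fold (fold x f (q * k)) f k     ≡⟨ cong (λ y → fold y f k) (fold-periodic f x k fᵏx≡x q) ⟩
  fold x f k                      ≡⟨ fᵏx≡x ⟩
  x                               ∎
  where open ≡-Reasoning

module _ {S : Subset n} {f : Fin n → Fin n} (f∈ : ∀ {x} → x ∈ S → f x ∈ S) (f-inj : InjectiveOn S f) where

  fold-∈ : ∀ {x} k → x ∈ S → fold x f k ∈ S
  fold-∈ zero    x∈S = x∈S
  fold-∈ (suc k) x∈S = f∈ (fold-∈ k x∈S)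

  fold-injectiveOn : ∀ k → InjectiveOn S (λ x → fold x f k)
  fold-injectiveOn zero    x∈S y∈S eq = eq
  fold-injectiveOn (suc k) x∈S y∈S eq =
    fold-injectiveOn k x∈S y∈S (f-inj (fold-∈ k x∈S) (fold-∈ k y∈S) eq)

  -- Among x, f x, …, fⁿ x two agree, so x has a period k ≤ n, and k divides n!.
  fold-n!-fixed : ∀ {x} → x ∈ S → fold x f (n !) ≡ x
  fold-n!-fixed {x} x∈S with pigeonhole (n<1+n n) (λ (i : Fin (suc n)) → fold x f (toℕ i))
  ... | i , j , i<j , fⁱx≡fʲx with 0<k≤n⇒k∣n! (m<n⇒0<n∸m i<j) k≤n
    where
    k≤n : toℕ j ∸ toℕ i ≤ n
    k≤n = ≤-trans (m∸n≤m (toℕ j) (toℕ i)) (≤-pred (toℕ<n j))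
  ...   | divides q n!≡q*k = trans (cong (fold x f) n!≡q*k) (fold-periodic f x k fᵏx≡x q)
    where
    k : ℕ
    k = toℕ j ∸ toℕ i
    fᵏx≡x : fold x f k ≡ x
    fᵏx≡x = sym (fold-injectiveOn (toℕ i) x∈S (fold-∈ k x∈S) (begin
      fold x f (toℕ i)             ≡⟨ fⁱx≡fʲx ⟩
      fold x f (toℕ j)             ≡⟨ cong (fold x f) (m+[n∸m]≡n (<⇒≤ i<j)) ⟨
      fold x f (toℕ i + k)         ≡⟨ fold-+ x f (toℕ i) ⟩
      fold (fold x f k) f (toℕ i)  ∎))
      where open ≡-Reasoning

does≡true⇒ : ∀ {a} {A : Set a} (a? : Dec A) → does a? ≡ true → A
does≡true⇒ (yes a) _ = a

infixr 9 _⨾_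

_⨾_ : HyperMap n → HyperMap n → HyperMap n
(h ⨾ k) d = tabulate (λ b → does (any? (λ e → (e ∈? h d) ×-dec (b ∈? k e))))

⨾⁺ : ∀ (h k : HyperMap n) {d e b} → e ∈ h d → b ∈ k e → b ∈ (h ⨾ k) d
⨾⁺ h k {d} {e} {b} e∈hd b∈ke =
  lookup⇒[]= b _ (trans (lookup∘tabulate _ b) (dec-true (any? _) (e , e∈hd , b∈ke)))

⨾⁻ : ∀ (h k : HyperMap n) {d b} → b ∈ (h ⨾ k) d → ∃ λ e → e ∈ h d × b ∈ k e
⨾⁻ h k {d} {b} b∈ =
  does≡true⇒ (any? _) (trans (sym (lookup∘tabulate _ b)) ([]=⇒lookup b∈))

⨾-surjective : ∀ {h k : HyperMap n} {P Q} →
  (∀ b → b ∈ Q → b ∈Img h [ P ]) → USurjective Q k → USurjective P (h ⨾ k)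
⨾-surjective {h = h} {k} Q⊆hP kQ b =
  let e , e∈Q , b∈ke = kQ b ; t , t∈P , e∈ht = Q⊆hP e e∈Q in t , t∈P , ⨾⁺ h k e∈ht b∈ke

⨾-totalˡ : ∀ {h k : HyperMap n} {P Q} →
  XTotal P h → (∀ t → t ∈ P → Nonempty (k t ∩ Q)) → XTotal Q (h ⨾ k)
⨾-totalˡ {h = h} {k} hP kQ d =
  let t , t∈ = hP d ; t∈hd , t∈P = x∈p∩q⁻ _ _ t∈ ; e , e∈ = kQ t t∈P ; e∈kt , e∈Q = x∈p∩q⁻ _ _ e∈
  in e , x∈p∩q⁺ (⨾⁺ h k t∈hd e∈kt , e∈Q)

⨾-totalʳ : ∀ {h k : HyperMap n} {Q} → (∀ d → Nonempty (h d)) → XTotal Q k → XTotal Q (h ⨾ k)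
⨾-totalʳ {h = h} {k} h≠∅ kQ d =
  let t , t∈hd = h≠∅ d ; e , e∈ = kQ t ; e∈kt , e∈Q = x∈p∩q⁻ _ _ e∈
  in e , x∈p∩q⁺ (⨾⁺ h k t∈hd e∈kt , e∈Q)

⨾-isSHE : ∀ (𝒟 : Structure n) {h k} → IsSHE 𝒟 h → IsSHE 𝒟 k → IsSHE 𝒟 (h ⨾ k)
⨾-isSHE 𝒟 {h} {k} ((h≠∅ , hD) , h-hom) ((k≠∅ , kD) , k-hom) =
  (nonempty , ⨾-surjective (λ b _ → hD b) kD) , hom
  where
  nonempty : ∀ d → Nonempty ((h ⨾ k) d)
  nonempty d = let t , t∈hd = h≠∅ d ; e , e∈kt = k≠∅ t in e , ⨾⁺ h k t∈hd e∈kt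
  hom : ∀ r a → Holds 𝒟 r a → ∀ b → (∀ j → b j ∈ (h ⨾ k) (a j)) → Holds 𝒟 r b
  hom r a Ra b b∈ = k-hom r (proj₁ ∘ mid) (h-hom r a Ra _ (proj₁ ∘ proj₂ ∘ mid)) b (proj₂ ∘ proj₂ ∘ mid)
    where
    mid : ∀ j → ∃ λ e → e ∈ h (a j) × b j ∈ k e
    mid j = ⨾⁻ h k (b∈ j)

-- Powers start at 1: the identity hyper-map preserves the relations only up to function extensionality.
_^1+_ : HyperMap n → ℕ → HyperMap n
h ^1+ zero  = h
h ^1+ suc k = h ⨾ h ^1+ k

^1+-surjective : ∀ {h : HyperMap n} {P} → USurjective P h → ∀ k → USurjective P (h ^1+ k)
^1+-surjective hP zero    = hP
^1+-surjective hP (suc k) = ⨾-surjective (λ b _ → hP b) (^1+-surjective hP k)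

^1+-total : ∀ {h : HyperMap n} {Q} → (∀ d → Nonempty (h d)) → XTotal Q h → ∀ k → XTotal Q (h ^1+ k)
^1+-total h≠∅ hQ zero    = hQ
^1+-total h≠∅ hQ (suc k) = ⨾-totalʳ h≠∅ (^1+-total h≠∅ hQ k)

^1+-isSHE : ∀ (𝒟 : Structure n) {h} → IsSHE 𝒟 h → ∀ k → IsSHE 𝒟 (h ^1+ k)
^1+-isSHE 𝒟 hS zero    = hS
^1+-isSHE 𝒟 hS (suc k) = ⨾-isSHE 𝒟 hS (^1+-isSHE 𝒟 hS k)

∈^1+-fold : ∀ {h : HyperMap n} {σ} → (∀ b → b ∈ h (σ b)) → ∀ k b → b ∈ (h ^1+ k) (fold b σ (suc k))
∈^1+-fold b∈hσb zero    b = b∈hσb b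
∈^1+-fold {h = h} {σ} b∈hσb (suc k) b = ⨾⁺ h (h ^1+ k) (b∈hσb (fold b σ (suc k))) (∈^1+-fold b∈hσb k b)

iterate∈^1+ : ∀ {h : HyperMap n} {τ} → (∀ d → τ d ∈ h d) → ∀ k d → iterate τ d (suc k) ∈ (h ^1+ k) d
iterate∈^1+ τd∈hd zero    d = τd∈hd d
iterate∈^1+ {h = h} τd∈hd (suc k) d = ⨾⁺ h (h ^1+ k) (τd∈hd d) (iterate∈^1+ τd∈hd k _)

module _ (𝒟 : Structure n) where

  MinU-∣∣-unique : ∀ {S S'} → MinU 𝒟 S → MinU 𝒟 S' → ∣ S ∣ ≡ ∣ S' ∣
  MinU-∣∣-unique (hasS , S-min) (hasS' , S'-min) = ≤-antisym (S-min _ hasS') (S'-min _ hasS)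

  MinX-∣∣-unique : ∀ {T T'} → MinX 𝒟 T → MinX 𝒟 T' → ∣ T ∣ ≡ ∣ T' ∣
  MinX-∣∣-unique (hasT , T-min) (hasT' , T'-min) = ≤-antisym (T-min _ hasT') (T'-min _ hasT)

  HasUSurjSHE-transfer : ∀ {U P w} → HasUSurjSHE 𝒟 U → IsSHE 𝒟 w →
    (∀ u → u ∈ U → u ∈Img w [ P ]) → HasUSurjSHE 𝒟 P
  HasUSurjSHE-transfer (f , fS , fU) wS U⊆wP = _ , ⨾-isSHE 𝒟 wS fS , ⨾-surjective U⊆wP fU

  HasXTotalSHE-transfer : ∀ {X P w} → HasXTotalSHE 𝒟 X → IsSHE 𝒟 w →
    (∀ t → t ∈ X → Nonempty (w t ∩ P)) → HasXTotalSHE 𝒟 P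
  HasXTotalSHE-transfer (g , gS , gX) wS wP = _ , ⨾-isSHE 𝒟 gS wS , ⨾-totalˡ gX wP

  MinU-≤ : ∀ {U P w} → MinU 𝒟 U → IsSHE 𝒟 w → (∀ u → u ∈ U → u ∈Img w [ P ]) → ∣ U ∣ ≤ ∣ P ∣
  MinU-≤ (hasU , U-min) wS U⊆wP = U-min _ (HasUSurjSHE-transfer hasU wS U⊆wP)

  MinX-≤ : ∀ {X P w} → MinX 𝒟 X → IsSHE 𝒟 w → (∀ t → t ∈ X → Nonempty (w t ∩ P)) → ∣ X ∣ ≤ ∣ P ∣
  MinX-≤ (hasX , X-min) wS wP = X-min _ (HasXTotalSHE-transfer hasX wS wP)

  MinU-choice-injective : ∀ {U w} → MinU 𝒟 U → IsSHE 𝒟 w →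
    ∀ s → (∀ b → b ∈ U → b ∈ w (s b)) → InjectiveOn U s
  MinU-choice-injective {U} minU wS s b∈wsb = ∣p∣≤∣image∣⇒injectiveOn s U
    (MinU-≤ minU wS (λ u u∈U → s u , ∈image⁺ s u∈U , b∈wsb u u∈U))

  MinX-choice-injective : ∀ {X w} → MinX 𝒟 X → IsSHE 𝒟 w →
    ∀ c → (∀ t → t ∈ X → c t ∈ w t) → InjectiveOn X c
  MinX-choice-injective {X} minX wS c ct∈wt = ∣p∣≤∣image∣⇒injectiveOn c X
    (MinX-≤ minX wS (λ t t∈X → c t , x∈p∩q⁺ (ct∈wt t t∈X , ∈image⁺ c t∈X)))

  -- Send everything in w x to x and everything else to some preimage; that choice is not injective.
  MinU-image-meets-once : ∀ {U w x e y} → MinU 𝒟 U → IsSHE 𝒟 w →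
    e ∈ w x → y ∈ w x → e ∈ U → y ∈ U → e ≡ y
  MinU-image-meets-once {U} {w} {x} {e} {y} minU wS@((_ , w-onto) , _) e∈wx y∈wx e∈U y∈U =
    MinU-choice-injective minU wS s b∈wsb e∈U y∈U (trans (s-on e∈wx) (sym (s-on y∈wx)))
    where
    s : Fin n → Fin n
    s b with b ∈? w x
    ... | yes _ = x
    ... | no  _ = proj₁ (w-onto b)
    b∈wsb : ∀ b → b ∈ U → b ∈ w (s b)
    b∈wsb b _ with b ∈? w x
    ... | yes b∈wx = b∈wx
    ... | no  _    = proj₂ (proj₂ (w-onto b))
    s-on : ∀ {b} → b ∈ w x → s b ≡ x
    s-on {b} b∈wx with b ∈? w x
    ... | yes _    = refl
    ... | no  b∉wx = contradiction b∈wx b∉wx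

  MinX-images-disjoint : ∀ {X w x y e} → MinX 𝒟 X → IsSHE 𝒟 w →
    e ∈ w x → e ∈ w y → x ∈ X → y ∈ X → x ≡ y
  MinX-images-disjoint {X} {w} {x} {y} {e} minX wS@((w≠∅ , _) , _) e∈wx e∈wy x∈X y∈X =
    MinX-choice-injective minX wS c ct∈wt x∈X y∈X (trans (c-on e∈wx) (sym (c-on e∈wy)))
    where
    c : Fin n → Fin n
    c t with e ∈? w t
    ... | yes _ = e
    ... | no  _ = proj₁ (w≠∅ t)
    ct∈wt : ∀ t → t ∈ X → c t ∈ w t
    ct∈wt t _ with e ∈? w t
    ... | yes e∈wt = e∈wt
    ... | no  _    = proj₂ (w≠∅ t)
    c-on : ∀ {t} → e ∈ w t → c t ≡ e
    c-on {t} e∈wt with e ∈? w t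
    ... | yes _    = refl
    ... | no  e∉wt = contradiction e∈wt e∉wt

  MinU-exchange : ∀ {U w u e d} → MinU 𝒟 U → IsSHE 𝒟 w → USurjective U w →
    u ∈ U → e ∈ U → u ∈ w e → u ∈ w d → MinU 𝒟 (exchange U e d)
  MinU-exchange {U} {w} {u} {e} {d} minU@(hasU , U-min) wS wU u∈U e∈U u∈we u∈wd =
    HasUSurjSHE-transfer hasU wS U⊆wE ,
    λ U'' hasU'' → ≤-trans (∣exchange∣≤ d e∈U) (U-min U'' hasU'')
    where
    U⊆wE : ∀ u' → u' ∈ U → u' ∈Img w [ exchange U e d ]
    U⊆wE u' u'∈U with u' ≟ u | wU u'
    ... | yes refl | _ = d , y∈exchange e d , u∈wd
    ... | no u'≢u | t , t∈U , u'∈wt with t ≟ e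
    ...   | yes refl = contradiction (MinU-image-meets-once minU wS u∈we u'∈wt u∈U u'∈U) (u'≢u ∘ sym)
    ...   | no  t≢e  = t , z∈exchange d t∈U t≢e , u'∈wt

  MinX-exchange : ∀ {X w x e y} → MinX 𝒟 X → IsSHE 𝒟 w → XTotal X w →
    x ∈ X → e ∈ X → e ∈ w x → y ∈ w x → MinX 𝒟 (exchange X e y)
  MinX-exchange {X} {w} {x} {e} {y} minX@(hasX , X-min) wS wX x∈X e∈X e∈wx y∈wx =
    HasXTotalSHE-transfer hasX wS wE ,
    λ X'' hasX'' → ≤-trans (∣exchange∣≤ y e∈X) (X-min X'' hasX'')
    where
    wE : ∀ t → t ∈ X → Nonempty (w t ∩ exchange X e y)
    wE t t∈X with t ≟ x | wX t
    ... | yes refl | _ = y , x∈p∩q⁺ (y∈wx , y∈exchange e y)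
    ... | no t≢x | e' , e'∈ with x∈p∩q⁻ _ _ e'∈ | e' ≟ e
    ...   | e∈wt , _     | yes refl = contradiction (MinX-images-disjoint minX wS e∈wx e∈wt x∈X t∈X) (t≢x ∘ sym)
    ...   | e'∈wt , e'∈X | no  e'≢e = e' , x∈p∩q⁺ (e'∈wt , z∈exchange y e'∈X e'≢e)

  USurjective-XTotal-SHE : ∀ {U X} → HasUSurjSHE 𝒟 U → HasXTotalSHE 𝒟 X →
    Σ[ p ∈ HyperMap n ] IsSHE 𝒟 p × USurjective U p × XTotal X p
  USurjective-XTotal-SHE (f , fS@((f≠∅ , _) , _) , fU) (g , gS@((_ , g-onto) , _) , gX) =
    f ⨾ g , ⨾-isSHE 𝒟 fS gS , ⨾-surjective (λ b _ → fU b) g-onto , ⨾-totalʳ f≠∅ gX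

  -- A choice for p is injective on U (resp. X), so it permutes U (resp. X) and its n!-th power is the
  -- identity there; following it backwards (resp. forwards) n! times puts d into p^(n!) d.
  reflexive-SHE : ∀ {U X} → MinU 𝒟 U → MinX 𝒟 X → (∀ d → d ∈ U ⊎ d ∈ X) →
    Σ[ z ∈ HyperMap n ] IsSHE 𝒟 z × USurjective U z × XTotal X z × (∀ d → d ∈ z d)
  reflexive-SHE {U} {X} minU minX U∪X-covers with USurjective-XTotal-SHE (proj₁ minU) (proj₁ minX)
  ... | p , pS@((p≠∅ , _) , _) , pU , pX =
    p ^1+ N , ^1+-isSHE 𝒟 pS N , ^1+-surjective pU N , ^1+-total p≠∅ pX N , d∈zd
    where
    N : ℕ
    N = pred (n !)
    1+N≡n! : suc N ≡ n !
    1+N≡n! = suc-pred (n !) {{n !≢0}}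

    σ : Fin n → Fin n
    σ b = proj₁ (pU b)
    b∈pσb : ∀ b → b ∈ p (σ b)
    b∈pσb b = proj₂ (proj₂ (pU b))
    σ-fixes-U : ∀ {d} → d ∈ U → fold d σ (suc N) ≡ d
    σ-fixes-U d∈U = trans (cong (fold _ σ) 1+N≡n!)
      (fold-n!-fixed (λ {b} _ → proj₁ (proj₂ (pU b)))
                     (MinU-choice-injective minU pS σ (λ b _ → b∈pσb b)) d∈U)

    τ : Fin n → Fin n
    τ d = proj₁ (pX d)
    τd∈pd : ∀ d → τ d ∈ p d
    τd∈pd d = proj₁ (x∈p∩q⁻ _ _ (proj₂ (pX d)))
    τ-fixes-X : ∀ {d} → d ∈ X → iterate τ d (suc N) ≡ d
    τ-fixes-X {d} d∈X = trans (sym (iterate-is-fold d τ (suc N))) (trans (cong (fold d τ) 1+N≡n!)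
      (fold-n!-fixed (λ {t} _ → proj₂ (x∈p∩q⁻ _ _ (proj₂ (pX t))))
                     (MinX-choice-injective minX pS τ (λ t _ → τd∈pd t)) d∈X))

    d∈zd : ∀ d → d ∈ (p ^1+ N) d
    d∈zd d with U∪X-covers d
    ... | inj₁ d∈U = subst (λ t → d ∈ (p ^1+ N) t) (σ-fixes-U d∈U) (∈^1+-fold b∈pσb N d)
    ... | inj₂ d∈X = subst (_∈ (p ^1+ N) d) (τ-fixes-X d∈X) (iterate∈^1+ τd∈pd N d)

  module UXCore {U X : Subset n} (sel : Selected 𝒟 U X) (U∪X≡⊤ : U ∪ X ≡ ⊤) where

    minU : MinU 𝒟 U
    minU = proj₁ sel

    minX : MinX 𝒟 X
    minX = proj₁ (proj₂ sel)

    minimal-sets-cover : ∀ {S T} → MinU 𝒟 S → MinX 𝒟 T → ∀ d → d ∈ S ⊎ d ∈ T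
    minimal-sets-cover {S} {T} minS minT d = x∈p∪q⁻ S T (subst (d ∈_) (sym S∪T≡⊤) ∈⊤)
      where
      open ≤-Reasoning
      n+∣U∩X∣≤∣S∪T∣+∣U∩X∣ : n + ∣ U ∩ X ∣ ≤ ∣ S ∪ T ∣ + ∣ U ∩ X ∣
      n+∣U∩X∣≤∣S∪T∣+∣U∩X∣ = begin
        n + ∣ U ∩ X ∣           ≡⟨ cong (λ k → k + ∣ U ∩ X ∣) (trans (cong ∣_∣ U∪X≡⊤) (∣⊤∣≡n n)) ⟨
        ∣ U ∪ X ∣ + ∣ U ∩ X ∣   ≡⟨ ∣p∪q∣+∣p∩q∣≡∣p∣+∣q∣ U X ⟩
        ∣ U ∣ + ∣ X ∣           ≡⟨ cong₂ _+_ (MinU-∣∣-unique minS minU) (MinX-∣∣-unique minT minX) ⟨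
        ∣ S ∣ + ∣ T ∣           ≡⟨ ∣p∪q∣+∣p∩q∣≡∣p∣+∣q∣ S T ⟨
        ∣ S ∪ T ∣ + ∣ S ∩ T ∣   ≤⟨ +-monoʳ-≤ ∣ S ∪ T ∣ (proj₂ (proj₂ sel) S T minS minT) ⟩
        ∣ S ∪ T ∣ + ∣ U ∩ X ∣   ∎
      S∪T≡⊤ : S ∪ T ≡ ⊤
      S∪T≡⊤ = ∣p∣≡n⇒p≡⊤ (≤-antisym (∣p∣≤n (S ∪ T)) (+-cancelʳ-≤ ∣ U ∩ X ∣ n _ n+∣U∩X∣≤∣S∪T∣+∣U∩X∣))

    ∉MinX⇒∈U : ∀ {T d} → MinX 𝒟 T → d ∉ T → d ∈ U
    ∉MinX⇒∈U minT d∉T with minimal-sets-cover minU minT _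
    ... | inj₁ d∈U = d∈U
    ... | inj₂ d∈T = contradiction d∈T d∉T

    ∉MinU⇒∈X : ∀ {S d} → MinU 𝒟 S → d ∉ S → d ∈ X
    ∉MinU⇒∈X minS d∉S with minimal-sets-cover minS minX _
    ... | inj₁ d∈S = contradiction d∈S d∉S
    ... | inj₂ d∈X = d∈X

    -- If y ∉ X, exchanging e for y in X keeps it minimal, so e and y both lie in U and in w x.
    XTotal-closed : ∀ {w x y} → IsSHE 𝒟 w → XTotal X w → x ∈ X → y ∈ w x → y ∈ X
    XTotal-closed {w} {x} {y} wS wX x∈X y∈wx with y ∈? X
    ... | yes y∈X = y∈X
    ... | no  y∉X = contradiction (MinU-image-meets-once minU wS e∈wx y∈wx e∈U (∉MinX⇒∈U minX y∉X)) e≢y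
      where
      e : Fin n
      e = proj₁ (wX x)
      e∈wx : e ∈ w x
      e∈wx = proj₁ (x∈p∩q⁻ _ _ (proj₂ (wX x)))
      e∈X : e ∈ X
      e∈X = proj₂ (x∈p∩q⁻ _ _ (proj₂ (wX x)))
      e≢y : e ≢ y
      e≢y refl = y∉X e∈X
      e∈U : e ∈ U
      e∈U = ∉MinX⇒∈U (MinX-exchange minX wS wX x∈X e∈X e∈wx y∈wx) (x∉exchange e≢y)

    USurjective-closed : ∀ {w u d} → IsSHE 𝒟 w → USurjective U w → u ∈ U → u ∈ w d → d ∈ U
    USurjective-closed {w} {u} {d} wS wU u∈U u∈wd with d ∈? U
    ... | yes d∈U = d∈U
    ... | no  d∉U = contradiction (MinX-images-disjoint minX wS u∈we u∈wd e∈X (∉MinU⇒∈X minU d∉U)) e≢d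
      where
      e : Fin n
      e = proj₁ (wU u)
      e∈U : e ∈ U
      e∈U = proj₁ (proj₂ (wU u))
      u∈we : u ∈ w e
      u∈we = proj₂ (proj₂ (wU u))
      e≢d : e ≢ d
      e≢d refl = d∉U e∈U
      e∈X : e ∈ X
      e∈X = ∉MinU⇒∈X (MinU-exchange minU wS wU u∈U e∈U u∈we u∈wd) (x∉exchange e≢d)

    X⊆ : ∀ {X'} → HasXTotalSHE 𝒟 X' → X ⊆ X'
    X⊆ {X'} (g' , g'S@((g'≠∅ , _) , _) , g'X')
      with reflexive-SHE minU minX (minimal-sets-cover minU minX)
    ... | z , zS , _ , zX , d∈zd = ∣p∣≤∣p∩q∣⇒p⊆q (MinX-≤ minX wS witnesses)
      where
      w : HyperMap n
      w = g' ⨾ z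
      wS : IsSHE 𝒟 w
      wS = ⨾-isSHE 𝒟 g'S zS
      wX' : XTotal X' w
      wX' = ⨾-totalˡ g'X' (λ t t∈X' → t , x∈p∩q⁺ (d∈zd t , t∈X'))
      witnesses : ∀ t → t ∈ X → Nonempty (w t ∩ (X ∩ X'))
      witnesses t t∈X =
        let c , c∈ = wX' t ; c∈wt , c∈X' = x∈p∩q⁻ _ _ c∈
        in c , x∈p∩q⁺ (c∈wt , x∈p∩q⁺ (XTotal-closed wS (⨾-totalʳ g'≠∅ zX) t∈X c∈wt , c∈X'))

    U⊆ : ∀ {U'} → HasUSurjSHE 𝒟 U' → U ⊆ U'
    U⊆ {U'} (f' , f'S@((_ , f'-onto) , _) , f'U')
      with reflexive-SHE minU minX (minimal-sets-cover minU minX)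
    ... | z , zS , zU , _ , d∈zd = ∣p∣≤∣p∩q∣⇒p⊆q (MinU-≤ minU wS witnesses)
      where
      w : HyperMap n
      w = z ⨾ f'
      wS : IsSHE 𝒟 w
      wS = ⨾-isSHE 𝒟 zS f'S
      wU' : USurjective U' w
      wU' = ⨾-surjective (λ b b∈U' → b , b∈U' , d∈zd b) f'U'
      witnesses : ∀ u → u ∈ U → u ∈Img w [ U ∩ U' ]
      witnesses u u∈U =
        let t , t∈U' , u∈wt = wU' u
        in t , x∈p∩q⁺ (USurjective-closed wS (⨾-surjective (λ b _ → zU b) f'-onto) u∈U u∈wt , t∈U') , u∈wt

theorem13 : (m : ℕ) (𝒟 : Structure (suc m)) (U X U' X' : Subset (suc m)) →
    Selected 𝒟 U X → Selected 𝒟 U' X' →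
    U ∪ X ≡ ⊤ → U' ∪ X' ≡ ⊤ →
    U ≡ U' × X ≡ X'
theorem13 m 𝒟 U X U' X' sel sel' U∪X≡⊤ U'∪X'≡⊤ =
  ⊆-antisym (C.U⊆ (proj₁ C'.minU)) (C'.U⊆ (proj₁ C.minU)) ,
  ⊆-antisym (C.X⊆ (proj₁ C'.minX)) (C'.X⊆ (proj₁ C.minX))
  where
  module C  = UXCore 𝒟 sel  U∪X≡⊤
  module C' = UXCore 𝒟 sel' U'∪X'≡⊤
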